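{- Let $\mathcal H=(V,E)$ be a connected hypergraph and fix a ribbon structure on $\mathrm{Bip}\,\mathcal H$, a base node $b_0$ and base edge $b_0b_1$. If $T$ is a $V$-cut Jaeger tree with respect to these data, then $T$ is an $E$-cut Jaeger tree with respect to the reversed ribbon structure, base node $b_0$, and base edge $b_0b_1^-$ (where $b_0b_1^-$ is the edge preceding $b_0b_1$ in the cyclic order at $b_0$ in the original ribbon structure).
   Context: $\mathrm{Bip}\,\mathcal H$ is the bipartite graph with color classes $V$ (violet nodes) and $E$ (emerald nodes), $v$ joined to $e$ iff $v\in e$; connected means $\mathrm{Bip}\,\mathcal H$ is connected. A ribbon structure assigns to each node $x$ a cyclic permutation of its incident edges; $xy^+$ (resp. $xy^-$) is the edge following (resp. preceding) $xy$ at $x$. The reversed ribbon structure replaces every cyclic permutation by its inverse. Tour of a spanning tree $T$ (with base node $b_0$, base edge $b_0b_1$): the sequence of pairs (current node, current edge) starting with $(b_0,b_0b_1)$; from $(x,xy)$ go to $(x,xy^+)$ if $xy\notin T$ and to $(y,yx^+)$ if $xy\in T$; stop right before $(b_0,b_0b_1)$ would recur. Each edge $xy$ appears exactly twice, as $(x,xy)$ and $(y,xy)$. A non-edge $xy$ of $T$ is cut at $x$ if $(x,xy)$ precedes $(y,xy)$. $T$ is a $V$-cut (resp. $E$-cut) Jaeger tree if every edge of $\mathrm{Bip}\,\mathcal H$ not in $T$ is cut at its violet (resp. emerald) endpoint. -}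

module Defs where

open import Data.Nat using (ℕ; zero; suc; _<_; _≤_; _≥_)
open import Data.Fin using (Fin)
open import Data.Bool using (Bool; true; false; if_then_else_)
open import Data.Sum using (_⊎_; inj₁; inj₂)
open import Data.Product using (_×_; _,_; ∃; ∃-syntax)
open import Data.Empty using (⊥)
open import Data.List using (List; []; _∷_; _++_; [_]; length)
open import Data.List.Relation.Unary.Linked using (Linked)
open import Data.List.Relation.Unary.Unique.Propositional using (Unique)
open import Relation.Binary.Construct.Closure.ReflexiveTransitive using (Star)
open import Relation.Binary.PropositionalEquality using (_≡_; _≢_)
open import Relation.Nullary using (¬_)
open import Function using (_∘_)

-- A hypergraph H = (V , E) with V = Fin n (violet) and E = Fin m (emerald);
-- hyperedge e contains vertex v iff inc v e ≡ true.
record Hypergraph : Set where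
  field
    n   : ℕ
    m   : ℕ
    inc : Fin n → Fin m → Bool
open Hypergraph public

Node : Hypergraph → Set
Node H = Fin (n H) ⊎ Fin (m H)

Adj : (H : Hypergraph) → Node H → Node H → Set
Adj H (inj₁ v) (inj₂ e) = inc H v e ≡ true
Adj H (inj₂ e) (inj₁ v) = inc H v e ≡ true
Adj H (inj₁ _) (inj₁ _) = ⊥
Adj H (inj₂ _) (inj₂ _) = ⊥

Connected : Hypergraph → Set
Connected H = ∀ (x y : Node H) → Star (Adj H) x y

EdgeSet : Hypergraph → Set
EdgeSet H = Fin (n H) → Fin (m H) → Bool

inT : (H : Hypergraph) → EdgeSet H → Node H → Node H → Bool
inT H T (inj₁ v) (inj₂ e) = T v e
inT H T (inj₂ e) (inj₁ v) = T v e
inT H T (inj₁ _) (inj₁ _) = false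
inT H T (inj₂ _) (inj₂ _) = false

TAdj : (H : Hypergraph) → EdgeSet H → Node H → Node H → Set
TAdj H T x y = inT H T x y ≡ true

HasCycle : {A : Set} → (A → A → Set) → Set
HasCycle {A} R = ∃[ x ] ∃[ xs ]
  (3 ≤ length (x ∷ xs) × Unique (x ∷ xs) × Linked R ((x ∷ xs) ++ [ x ]))

IsSpanningTree : (H : Hypergraph) → EdgeSet H → Set
IsSpanningTree H T =
  (∀ v e → T v e ≡ true → inc H v e ≡ true)
  × (∀ (x y : Node H) → Star (TAdj H T) x y)
  × ¬ HasCycle (TAdj H T)

iter : {A : Set} → ℕ → (A → A) → A → A
iter zero    f a = a
iter (suc k) f a = f (iter k f a)

-- The edge xy is identified with its other endpoint y,
-- so  xy⁺ = x (σ x y)  and  xy⁻ = x (σ⁻ x y).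
record Ribbon (H : Hypergraph) : Set where
  field
    σ     : Node H → Node H → Node H
    σ⁻    : Node H → Node H → Node H
    σ-adj  : ∀ x y → Adj H x y → Adj H x (σ x y)
    σ⁻-adj : ∀ x y → Adj H x y → Adj H x (σ⁻ x y)
    σ⁻σ   : ∀ x y → Adj H x y → σ⁻ x (σ x y) ≡ y
    σσ⁻   : ∀ x y → Adj H x y → σ x (σ⁻ x y) ≡ y
    cyclic : ∀ x y z → Adj H x y → Adj H x z → ∃[ k ] iter k (σ x) y ≡ z
open Ribbon public

-- Tour state (current node x , current edge xy), written as the pair (x , y).
State : Hypergraph → Set
State H = Node H × Node H

step : (H : Hypergraph) → (Node H → Node H → Node H) → EdgeSet H
     → State H → State H
step H next T (x , y) = if inT H T x y then (y , next y x) else (x , next x y)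

-- The non-edge xy is cut at x in the tour of T (successor rule next,
-- base node b₀, base edge b₀b₁): (x , xy) occurs before (y , xy) in the
-- tour, i.e. within the first period before (b₀ , b₀b₁) recurs.
CutAt : (H : Hypergraph) → (Node H → Node H → Node H) → EdgeSet H
      → (b₀ b₁ : Node H) → (x y : Node H) → Set
CutAt H next T b₀ b₁ x y = ∃[ i ] ∃[ j ]
  ( i < j
  × iter i (step H next T) (b₀ , b₁) ≡ (x , y)
  × iter j (step H next T) (b₀ , b₁) ≡ (y , x)
  × (∀ k → 0 < k → k ≤ j → iter k (step H next T) (b₀ , b₁) ≢ (b₀ , b₁)))

VCutJaeger : (H : Hypergraph) → (Node H → Node H → Node H) → (b₀ b₁ : Node H)
           → EdgeSet H → Set
VCutJaeger H next b₀ b₁ T = IsSpanningTree H T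
  × (∀ v e → inc H v e ≡ true → T v e ≡ false
       → CutAt H next T b₀ b₁ (inj₁ v) (inj₂ e))

ECutJaeger : (H : Hypergraph) → (Node H → Node H → Node H) → (b₀ b₁ : Node H)
           → EdgeSet H → Set
ECutJaeger H next b₀ b₁ T = IsSpanningTree H T
  × (∀ v e → inc H v e ≡ true → T v e ≡ false
       → CutAt H next T b₀ b₁ (inj₂ e) (inj₁ v))

module Submission where

-- Write ψ(x , xz) = (x , xz⁻) ("turn back by one edge").  One step of
-- the tour for the reversed ribbon structure, started at ψ(a), lands at
-- ψ(a') where a' is the state the original tour visits just BEFORE a.  Hence,
-- if P is the period of the original tour (s₀ , s₁ , … , s_P = s₀), the tour
-- for the reversed structure from ψ(s₀) = (b₀ , b₀b₁⁻) is
--     r_k = ψ(s_{P-k})      (0 ≤ k ≤ P),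
-- i.e. the original tour read backwards.  For a non-edge xy of T the step
-- from (x , xy) is (x , xy⁺), so ψ(s_{j+1}) = (x , xy) when s_j = (x , xy).
-- Therefore (y , xy) before (x , xy) in the original tour becomes
-- (x , xy) before (y , xy) in the reversed one: a cut at the violet end
-- turns into a cut at the emerald end, and the spanning tree is unchanged.

open import Defs
open import Data.Nat using (ℕ; zero; suc; _+_; _*_; _∸_; _<_; _≤_; z<s; s≤s; _≤?_)
open import Data.Nat.Properties
open import Data.Fin using (Fin; toℕ; join; combine; splitAt)
import Data.Fin.Properties as Fin
open import Data.Bool using (true; false; if_then_else_)
open import Data.Sum using (_⊎_; inj₁; inj₂)
open import Data.Product using (_×_; _,_; ∃-syntax; proj₁; proj₂)
open import Data.Empty using (⊥-elim)
open import Relation.Binary.PropositionalEquality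
open import Relation.Nullary using (¬_; yes; no)
open import Relation.Nullary.Decidable using (map′)
open import Relation.Unary using (Decidable)
open import Function using (_∘_)

iter-suc : {A : Set} (k : ℕ) (f : A → A) (a : A) → iter (suc k) f a ≡ iter k f (f a)
iter-suc zero    f a = refl
iter-suc (suc k) f a = cong f (iter-suc k f a)

Least : (ℕ → Set) → ℕ → Set
Least Q m = Q m × (∀ k → k < m → ¬ Q k)

least-below : {Q : ℕ → Set} → Decidable Q → ∀ n
            → (∃[ m ] (m < n × Least Q m)) ⊎ (∀ k → k < n → ¬ Q k)
least-below Q? zero = inj₂ (λ _ ())
least-below {Q} Q? (suc n) with least-below Q? n
... | inj₁ (m , m<n , least) = inj₁ (m , m<n⇒m<1+n m<n , least)
... | inj₂ none with Q? n
...   | yes qn = inj₁ (n , n<1+n n , qn , none)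
...   | no ¬qn = inj₂ none′
  where
  none′ : ∀ k → k < suc n → ¬ Q k
  none′ k k<1+n with m<1+n⇒m<n∨m≡n k<1+n
  ... | inj₁ k<n  = none k k<n
  ... | inj₂ refl = ¬qn

least-witness : {Q : ℕ → Set} → Decidable Q → ∀ {n} → Q n → ∃[ m ] Least Q m
least-witness Q? {n} qn with least-below Q? (suc n)
... | inj₁ (m , _ , least) = m , least
... | inj₂ none            = ⊥-elim (none n (n<1+n n) qn)

module ReversibleOrbit {A : Set} (f g : A → A) (a₀ : A)
  (undo : ∀ k → g (iter (suc k) f a₀) ≡ iter k f a₀) where

  orbit : ℕ → A
  orbit k = iter k f a₀

  unwind : ∀ a b → a ≤ b → orbit a ≡ orbit b → a₀ ≡ orbit (b ∸ a)
  unwind zero    b       _         eq = eq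
  unwind (suc a) (suc b) (s≤s a≤b) eq =
    unwind a b a≤b (trans (sym (undo a)) (trans (cong g eq) (undo b)))

  module Finite {N : ℕ} (enc : A → Fin N)
    (enc-injective : ∀ a b → enc a ≡ enc b → a ≡ b) where

    -- Pigeonhole gives a repetition among N + 1 orbit points; unwind it.
    returns : ∃[ P ] (0 < P × orbit P ≡ a₀)
    returns with Fin.pigeonhole (n<1+n N) (λ i → enc (orbit (toℕ i)))
    ... | i , j , i<j , eq =
      toℕ j ∸ toℕ i , m<n⇒0<n∸m i<j ,
      sym (unwind (toℕ i) (toℕ j) (<⇒≤ i<j) (enc-injective _ _ eq))

    returns? : Decidable (λ k → orbit (suc k) ≡ a₀)
    returns? k = map′ (enc-injective _ _) (cong enc) (enc (orbit (suc k)) Fin.≟ enc a₀)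

    period : ∃[ P ] (0 < P × orbit P ≡ a₀ × (∀ k → 0 < k → k < P → orbit k ≢ a₀))
    period with returns
    ... | zero  , () , _
    ... | suc p , _  , ret with least-witness returns? {p} ret
    ...   | m , ret′ , earlier = suc m , z<s , ret′ , no-earlier
      where
      no-earlier : ∀ k → 0 < k → k < suc m → orbit k ≢ a₀
      no-earlier (suc k) _ (s≤s k<m) = earlier k k<m

  module Backwards (h ψ : A → A) (conj : ∀ a → h (ψ a) ≡ ψ (g a)) where

    run-back : ∀ k t → iter k h (ψ (orbit (t + k))) ≡ ψ (orbit t)
    run-back zero    t rewrite +-identityʳ t = refl
    run-back (suc k) t = begin
        iter (suc k) h (ψ (orbit (t + suc k)))
      ≡⟨ iter-suc k h _ ⟩
        iter k h (h (ψ (orbit (t + suc k))))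
      ≡⟨ cong (λ u → iter k h (h (ψ (orbit u)))) (+-suc t k) ⟩
        iter k h (h (ψ (orbit (suc (t + k)))))
      ≡⟨ cong (iter k h) (conj (orbit (suc (t + k)))) ⟩
        iter k h (ψ (g (orbit (suc (t + k)))))
      ≡⟨ cong (λ u → iter k h (ψ u)) (undo (t + k)) ⟩
        iter k h (ψ (orbit (t + k)))
      ≡⟨ run-back k t ⟩
        ψ (orbit t) ∎
      where open ≡-Reasoning

    reversed-orbit : ∀ {P} → orbit P ≡ a₀ → ∀ k → k ≤ P
                   → iter k h (ψ a₀) ≡ ψ (orbit (P ∸ k))
    reversed-orbit {P} ret k k≤P = begin
        iter k h (ψ a₀)
      ≡⟨ cong (λ u → iter k h (ψ u)) (sym ret) ⟩
        iter k h (ψ (orbit P))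
      ≡⟨ cong (λ u → iter k h (ψ (orbit u))) (sym (m∸n+n≡m k≤P)) ⟩
        iter k h (ψ (orbit (P ∸ k + k)))
      ≡⟨ run-back k (P ∸ k) ⟩
        ψ (orbit (P ∸ k)) ∎
      where open ≡-Reasoning

module Tour (H : Hypergraph) (R : Ribbon H) (T : EdgeSet H) where

  adj-sym : ∀ x y → Adj H x y → Adj H y x
  adj-sym (inj₁ _) (inj₂ _) a = a
  adj-sym (inj₂ _) (inj₁ _) a = a

  inT-sym : ∀ x y → inT H T x y ≡ inT H T y x
  inT-sym (inj₁ _) (inj₂ _) = refl
  inT-sym (inj₂ _) (inj₁ _) = refl
  inT-sym (inj₁ _) (inj₁ _) = refl
  inT-sym (inj₂ _) (inj₂ _) = refl

  Proper : State H → Set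
  Proper (x , y) = Adj H x y

  tour-step reversed-step : State H → State H
  tour-step     = step H (σ R) T
  reversed-step = step H (σ⁻ R) T

  tour-step-proper : ∀ a → Proper a → Proper (tour-step a)
  tour-step-proper (x , y) a with inT H T x y
  ... | true  = σ-adj R y x (adj-sym x y a)
  ... | false = σ-adj R x y a

  -- The state from which the tour arrives at (x , xz): along the edge
  -- y = xz⁻ from y's side if xy ∈ T, and from (x , xy) otherwise.
  untour-step : State H → State H
  untour-step (x , z) =
    if inT H T x (σ⁻ R x z) then (σ⁻ R x z , x) else (x , σ⁻ R x z)

  untour-tour : ∀ a → Proper a → untour-step (tour-step a) ≡ a
  untour-tour (x , y) a with inT H T x y in xy∈?
  ... | true  rewrite σ⁻σ R y x (adj-sym x y a) | inT-sym y x | xy∈? = refl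
  ... | false rewrite σ⁻σ R x y a | xy∈? = refl

  turn-back : State H → State H
  turn-back (x , z) = (x , σ⁻ R x z)

  turn-back-injective : ∀ a b → Proper a → Proper b → turn-back a ≡ turn-back b → a ≡ b
  turn-back-injective (x , z) (x′ , z′) a b eq with cong proj₁ eq
  ... | refl = cong (x ,_) (begin
      z                      ≡⟨ sym (σσ⁻ R x z a) ⟩
      σ R x (σ⁻ R x z)       ≡⟨ cong (σ R x ∘ proj₂) eq ⟩
      σ R x (σ⁻ R x z′)      ≡⟨ σσ⁻ R x z′ b ⟩
      z′                     ∎)
    where open ≡-Reasoning

  reversed-conjugate : ∀ a → reversed-step (turn-back a) ≡ turn-back (untour-step a)
  reversed-conjugate (x , z) with inT H T x (σ⁻ R x z)
  ... | true  = refl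
  ... | false = refl

  -- From a non-edge the tour just rotates, and turn-back rotates back.
  turn-back-nonedge : ∀ x y → inT H T x y ≡ false → Adj H x y
                    → turn-back (tour-step (x , y)) ≡ (x , y)
  turn-back-nonedge x y xy∉T a rewrite xy∉T = cong (x ,_) (σ⁻σ R x y a)

  encode : State H → Fin ((n H + m H) * (n H + m H))
  encode (x , y) = combine (join (n H) (m H) x) (join (n H) (m H) y)

  encode-injective : ∀ a b → encode a ≡ encode b → a ≡ b
  encode-injective (x , y) (x′ , y′) eq with Fin.combine-injective _ _ _ _ eq
  ... | eqx , eqy = cong₂ _,_ (join-injective eqx) (join-injective eqy)
    where
    join-injective : ∀ {u w : Node H} → join (n H) (m H) u ≡ join (n H) (m H) w → u ≡ w
    join-injective {u} {w} e = trans (sym (Fin.splitAt-join (n H) (m H) u))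
      (trans (cong (splitAt (n H)) e) (Fin.splitAt-join (n H) (m H) w))

module BasedTour (H : Hypergraph) (R : Ribbon H) (T : EdgeSet H)
  (b₀ b₁ : Node H) (base-adj : Adj H b₀ b₁) where
  open Tour H R T

  tour-proper : ∀ k → Proper (iter k tour-step (b₀ , b₁))
  tour-proper zero    = base-adj
  tour-proper (suc k) = tour-step-proper _ (tour-proper k)

  open ReversibleOrbit tour-step untour-step (b₀ , b₁) (λ k → untour-tour _ (tour-proper k))
  open Finite encode encode-injective
  open Backwards reversed-step turn-back reversed-conjugate

  cut-reverses : ∀ x y → inT H T x y ≡ false → Adj H x y
               → CutAt H (σ R) T b₀ b₁ y x → CutAt H (σ⁻ R) T b₀ (σ⁻ R b₀ b₁) x y
  cut-reverses x y xy∉T xy (i , j , i<j , visit-yx , visit-xy , no-return) with period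
  ... | P , 0<P , ret , minimal =
    P ∸ suc j , P ∸ suc i , ∸-monoʳ-< (s≤s i<j) j<P ,
    reversed-visit j j<P visit-xy xy∉T xy ,
    reversed-visit i i<P visit-yx (trans (inT-sym y x) xy∉T) (adj-sym x y xy) ,
    no-return′
    where
    r : ℕ → State H
    r k = iter k reversed-step (b₀ , σ⁻ R b₀ b₁)

    j<P : j < P
    j<P with P ≤? j
    ... | yes P≤j = ⊥-elim (no-return P 0<P P≤j ret)
    ... | no  P≰j = ≰⇒> P≰j

    i<P : i < P
    i<P = <-trans i<j j<P

    -- Time P - (t+1) of the reversed tour corresponds to time t+1 of the
    -- tour; if the tour is at a non-edge uw at time t, the reversed tour is
    -- at the same state at time P - (t+1).
    reversed-visit : ∀ t {u w} → t < P → orbit t ≡ (u , w)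
                   → inT H T u w ≡ false → Adj H u w → r (P ∸ suc t) ≡ (u , w)
    reversed-visit t {u} {w} t<P visit uw∉T uw = begin
        r (P ∸ suc t)
      ≡⟨ reversed-orbit ret (P ∸ suc t) (m∸n≤m P (suc t)) ⟩
        turn-back (orbit (P ∸ (P ∸ suc t)))
      ≡⟨ cong (turn-back ∘ orbit) (m∸[m∸n]≡n t<P) ⟩
        turn-back (tour-step (orbit t))
      ≡⟨ cong (turn-back ∘ tour-step) visit ⟩
        turn-back (tour-step (u , w))
      ≡⟨ turn-back-nonedge u w uw∉T uw ⟩
        (u , w) ∎
      where open ≡-Reasoning

    -- A return of the reversed tour would be an early return of the tour.
    no-return′ : ∀ k → 0 < k → k ≤ P ∸ suc i → r k ≢ (b₀ , σ⁻ R b₀ b₁)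
    no-return′ k 0<k k≤ eq = minimal (P ∸ k) (m<n⇒0<n∸m k<P) (∸-monoʳ-< 0<k (<⇒≤ k<P)) back-at-start
      where
      k<P : k < P
      k<P = ≤-<-trans k≤ (∸-monoʳ-< {o = 0} z<s i<P)

      back-at-start : orbit (P ∸ k) ≡ (b₀ , b₁)
      back-at-start = turn-back-injective _ _ (tour-proper (P ∸ k)) base-adj
        (trans (sym (reversed-orbit ret k (<⇒≤ k<P))) eq)

lemma6p5 : (H : Hypergraph) → Connected H → (R : Ribbon H)
    → (b₀ b₁ : Node H) → Adj H b₀ b₁ → (T : EdgeSet H)
    → VCutJaeger H (σ R) b₀ b₁ T
    → ECutJaeger H (σ⁻ R) b₀ (σ⁻ R b₀ b₁) T
lemma6p5 H _ R b₀ b₁ base-adj T (spanning , violet-cuts) =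
  spanning , λ v e v∈e ve∉T →
    BasedTour.cut-reverses H R T b₀ b₁ base-adj (inj₂ e) (inj₁ v) ve∉T v∈e
      (violet-cuts v e v∈e ve∉T)
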